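{- Let $R$ be a finite group and $Q$ a subgroup of $R$ with exactly $\ell$ double cosets $QxQ$ in $R$. Let $\mathcal{L}$ be the set of inverse-closed subsets $S\subseteq R$ that intersect every double coset $QxQ$ evenly. Then $|\mathcal{L}|\leq 2^{\mathbf{c}(R)-\frac12|R:Q|+\frac12\ell}$.
   Context: $\mathcal{I}(X)$ is the set of elements of $X$ of order at most $2$ and $\mathbf{c}(X)=(|X|+|\mathcal{I}(X)|)/2$. A subset $S$ is inverse-closed if $S=S^{ -1}$. If $\Delta$ is a union of right $Q$-cosets $\Lambda_1,\dots,\Lambda_b$, then $S$ intersects $\Delta$ evenly if $|S\cap\Lambda_1|=\dots=|S\cap\Lambda_b|$. -}

module Defs where

open import Data.Nat using (ℕ; zero; suc; NonZero; >-nonZero; z≤n; _^_; _*_; _+_; _≤_)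
open import Data.Nat.DivMod using (_/_)
import Data.Nat.Properties as ℕP
open import Data.Fin using (Fin)
open import Data.Fin.Properties using (any?; all?)
open import Data.Fin.Subset using (Subset; _∈_; ∣_∣; inside; outside)
open import Data.Fin.Subset.Properties using (_∈?_; x∈p⇒∣p-x∣<∣p∣)
open import Data.Vec using (Vec; []; _∷_; tabulate)
open import Data.List using (List; []; _∷_; length; filter; map; _++_)
open import Data.Product using (Σ; _×_; _,_; ∃)
open import Relation.Nullary using (Dec; yes; no; does; ¬_; ¬?)
open import Relation.Nullary.Decidable using (_×-dec_; _→-dec_)
open import Relation.Binary.PropositionalEquality using (_≡_)
open import Algebra.Structures using (IsGroup)
open import Function.Bundles using (_⇔_; mk⇔; Equivalence)

-- A finite group of order n: a group structure on Fin n
-- (with propositional equality).  Every finite group is isomorphic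
-- to one of these.

record FinGroup (n : ℕ) : Set where
  infixl 7 _∙_
  field
    _∙_     : Fin n → Fin n → Fin n
    ε       : Fin n
    _⁻¹     : Fin n → Fin n
    isGroup : IsGroup _≡_ _∙_ ε _⁻¹

countFin : ∀ {n} {P : Fin n → Set} → ((x : Fin n) → Dec (P x)) → ℕ
countFin P? = ∣ tabulate (λ x → if-dec (P? x)) ∣
  where
  if-dec : ∀ {A : Set} → Dec A → Data.Fin.Subset.Side
  if-dec (yes _) = inside
  if-dec (no _)  = outside

_⇔-dec_ : ∀ {A B : Set} → Dec A → Dec B → Dec (A ⇔ B)
a ⇔-dec b with a →-dec b | b →-dec a
... | yes f | yes g = yes (mk⇔ f g)
... | no ¬f | _     = no (λ e → ¬f (Equivalence.to e))
... | _     | no ¬g = no (λ e → ¬g (Equivalence.from e))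

allSubsets : (n : ℕ) → List (Subset n)
allSubsets zero    = [] ∷ []
allSubsets (suc n) = map (inside ∷_) (allSubsets n) ++ map (outside ∷_) (allSubsets n)

module _ {n : ℕ} (R : FinGroup n) where
  open FinGroup R

  record IsSubgroup (Q : Subset n) : Set where
    field
      ε∈    : ε ∈ Q
      ∙-closed : ∀ {x y} → x ∈ Q → y ∈ Q → (x ∙ y) ∈ Q
      ⁻¹-closed : ∀ {x} → x ∈ Q → (x ⁻¹) ∈ Q

  InRightCoset : Subset n → Fin n → Fin n → Set
  InRightCoset Q x y = ∃ λ q → q ∈ Q × y ≡ q ∙ x

  inRightCoset? : ∀ Q x y → Dec (InRightCoset Q x y)
  inRightCoset? Q x y = any? (λ q → (q ∈? Q) ×-dec (y Data.Fin.≟ (q ∙ x)))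

  InDoubleCoset : Subset n → Fin n → Fin n → Set
  InDoubleCoset Q x y = ∃ λ q → ∃ λ q' → q ∈ Q × q' ∈ Q × y ≡ q ∙ x ∙ q'

  inDoubleCoset? : ∀ Q x y → Dec (InDoubleCoset Q x y)
  inDoubleCoset? Q x y =
    any? (λ q → any? (λ q' → (q ∈? Q) ×-dec ((q' ∈? Q) ×-dec (y Data.Fin.≟ (q ∙ x ∙ q')))))

  -- The number of double cosets QxQ: each double coset is counted once,
  -- via its least element (in the order of Fin n).
  IsLeastInDoubleCoset : Subset n → Fin n → Set
  IsLeastInDoubleCoset Q x = ∀ y → y Data.Fin.< x → ¬ InDoubleCoset Q x y

  isLeast? : ∀ Q x → Dec (IsLeastInDoubleCoset Q x)
  isLeast? Q x = all? (λ y → (y Data.Fin.<? x) →-dec ¬? (inDoubleCoset? Q x y))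

  numDoubleCosets : Subset n → ℕ
  numDoubleCosets Q = countFin (isLeast? Q)

  index : (Q : Subset n) → IsSubgroup Q → ℕ
  index Q sg = _/_ n ∣ Q ∣ {{nz}}
    where
    nz : NonZero ∣ Q ∣
    nz = >-nonZero (ℕP.≤-<-trans z≤n (x∈p⇒∣p-x∣<∣p∣ (IsSubgroup.ε∈ sg)))

  numInvolutions : ℕ
  numInvolutions = countFin (λ x → (x ∙ x) Data.Fin.≟ ε)

  InverseClosed : Subset n → Set
  InverseClosed S = ∀ x → (x ∈ S) ⇔ ((x ⁻¹) ∈ S)

  cardInterRightCoset : Subset n → Subset n → Fin n → ℕ
  cardInterRightCoset Q S y = countFin (λ z → (z ∈? S) ×-dec inRightCoset? Q y z)

  -- S intersects every double coset QxQ evenly: all right Q-cosets Qy, Qz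
  -- contained in QxQ (i.e. y, z ∈ QxQ) meet S in the same number of elements.
  IntersectsDoubleCosetsEvenly : Subset n → Subset n → Set
  IntersectsDoubleCosetsEvenly Q S =
    ∀ x y z → InDoubleCoset Q x y → InDoubleCoset Q x z →
      cardInterRightCoset Q S y ≡ cardInterRightCoset Q S z

  inverseClosed? : ∀ S → Dec (InverseClosed S)
  inverseClosed? S = all? (λ x → (x ∈? S) ⇔-dec ((x ⁻¹) ∈? S))

  evenly? : ∀ Q S → Dec (IntersectsDoubleCosetsEvenly Q S)
  evenly? Q S = all? (λ x → all? (λ y → all? (λ z →
      inDoubleCoset? Q x y →-dec (inDoubleCoset? Q x z →-dec
        (cardInterRightCoset Q S y ℕP.≟ cardInterRightCoset Q S z)))))

  InL : Subset n → Subset n → Set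
  InL Q S = InverseClosed S × IntersectsDoubleCosetsEvenly Q S

  cardL : Subset n → ℕ
  cardL Q = length (filter (λ S → inverseClosed? S ×-dec evenly? Q S) (allSubsets n))

{-# OPTIONS --safe #-}
module Submission where

-- A right coset Q x is leading if x is the least element of its double coset; ℓ of the
-- |R:Q| right cosets are leading.  For a non-leading coset Q x whose double coset has leading
-- coset Q d, evenness gives |S ∩ Q x| = |S ∩ Q d| for every S ∈ 𝓛.  Mark in Q x a pair
-- {p, p⁻¹}, with p⁻¹ ∈ Q x as well when Q x Q is self-inverse.  If the selected cosets are such
-- that no leading coset contains a mark and no selected coset contains a mark of another one,
-- then S ∈ 𝓛 is determined by its values off the marks, the count on Q d fixing the value at p.
-- Selecting x only when min (Q x Q) ⊑ min (Q x⁻¹ Q) for a total order ⊑ achieves this, and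
-- with ⊑ = ≤ and ⊑ = ≥ every non-leading coset is selected at least once.  An inverse-closed
-- set is determined by its values on {y : y ⊑ y⁻¹}, which meets every marked pair, so
-- |𝓛| · 2^#selected ≤ 2^#{y : y ⊑ y⁻¹}.  Multiplying the bounds for ≤ and ≥, whose sets cover
-- R and overlap exactly in the involutions, gives |𝓛|² · 2^(|R:Q| − ℓ) ≤ 2^(|R| + |𝓘(R)|).

open import Level using (0ℓ)
open import Data.Bool using (true)
open import Data.Empty using (⊥-elim)
open import Data.Fin using (Fin; zero; suc; _<?_; _≟_) renaming (_<_ to _<ᶠ_)
open import Data.Fin.Properties using (<-cmp; all?; any?; ≤-total; ≤-isDecTotalOrder)
  renaming (≤-antisym to ≤ᶠ-antisym)
open import Data.Fin.Subset using (Subset; inside; outside; ∣_∣; _∈_; _⊆_) renaming (_∩_ to _∩ₛ_)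
open import Data.Fin.Subset.Properties
  using (_∈?_; x∈p∩q⁺; x∈p∩q⁻; drop-there; drop-∷-⊆; p∩q⊆q; x∈p⇒∣p-x∣<∣p∣; ⊆-antisym)
open import Data.List using (List; []; _∷_; _++_; length; filter; map; tabulate; allFin; cartesianProduct)
open import Data.List.Properties using (length-++; length-map; length-tabulate)
import Data.List.Membership.Propositional as List
open import Data.List.Membership.Propositional.Properties
  using (∈-∃++; ∈-++⁺ˡ; ∈-++⁺ʳ; ∈-++⁻; ∈-map⁺; ∈-map⁻; ∈-filter⁺; ∈-filter⁻; ∈-allFin; ∈-cartesianProduct⁺)
open import Data.List.Relation.Unary.Any using (here; there)
open import Data.List.Relation.Unary.All using ([]; _∷_)
import Data.List.Relation.Unary.All as All
open import Data.List.Relation.Unary.AllPairs using ([]; _∷_)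
open import Data.List.Relation.Unary.Unique.Propositional using (Unique)
import Data.List.Relation.Unary.Unique.Propositional.Properties as Unique
open import Data.Nat using (ℕ; zero; suc; _+_; _*_; _^_; _≤_; _<_; z≤n; s≤s; NonZero; >-nonZero)
open import Data.Nat.Solver using (module +-*-Solver)
open import Data.Nat.DivMod using (_/_; /-monoˡ-≤; m*n/n≡m)
open import Data.Nat.Properties
  using (≤-trans; ≤-antisym; ≤-reflexive; ≤-<-trans; +-identityʳ; <-irrefl; *-comm;
         *-mono-≤; ^-monoʳ-≤; ^-distribˡ-+-*; +-monoʳ-≤; +-monoˡ-≤; +-assoc; *-monoʳ-≤; *-monoˡ-≤; module ≤-Reasoning)
open import Data.Product using (Σ; _×_; _,_; proj₁; proj₂)
open import Data.Sum using (_⊎_; inj₁; inj₂; [_,_])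
open import Data.Vec.Properties using (lookup∘tabulate; []=⇒lookup; lookup⇒[]=)
import Data.Vec.Base as Vec
open import Data.Vec.Base using ([]; _∷_)
open import Relation.Nullary using (Dec; yes; no; does; ¬_; ¬?)
open import Relation.Nullary.Decidable using (_×-dec_; _⊎-dec_; _→-dec_)
open import Relation.Binary using (Rel; IsEquivalence; tri<; tri≈; tri>)
import Relation.Binary as B
import Relation.Binary.Construct.Flip.EqAndOrd as Flip
open import Algebra.Bundles using (Group)
open import Algebra.Structures using (IsGroup)
import Algebra.Properties.Group as GroupProperties
open import Function.Bundles using (_⇔_; mk⇔; Equivalence)
import Function.Properties.Equivalence as ⇔
open import Relation.Unary using (Pred; Decidable; _∪_; _∩_; ∁) renaming (_⊆_ to _⊆ᵖ_)
open import Relation.Unary.Properties using (_∪?_; _∩?_; ∁?)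
open import Relation.Binary.PropositionalEquality
  using (_≡_; _≢_; refl; sym; trans; cong; cong₂; subst; subst₂; module ≡-Reasoning)

open import Defs

2^[x+y+z] : ∀ x y z → 2 ^ (x + y + z) ≡ 2 ^ x * 2 ^ y * 2 ^ z
2^[x+y+z] x y z = trans (^-distribˡ-+-* 2 (x + y) z) (cong (_* 2 ^ z) (^-distribˡ-+-* 2 x y))

a*a*[b*c*d]≡a*b*[a*c]*d : ∀ a b c d → a * a * (b * c * d) ≡ a * b * (a * c) * d
a*a*[b*c*d]≡a*b*[a*c]*d = solve 4 (λ a b c d → a :* a :* (b :* c :* d) := a :* b :* (a :* c) :* d) refl
  where open +-*-Solver

∈-++-∷⁻ : ∀ {A : Set} {v w : A} us {vs} → v List.∈ us ++ w ∷ vs → v ≢ w → v List.∈ us ++ vs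
∈-++-∷⁻ []       (here v≡w)  v≢w = ⊥-elim (v≢w v≡w)
∈-++-∷⁻ []       (there v∈)  v≢w = v∈
∈-++-∷⁻ (u ∷ us) (here v≡u)  v≢w = here v≡u
∈-++-∷⁻ (u ∷ us) (there v∈)  v≢w = there (∈-++-∷⁻ us v∈ v≢w)

length-++-∷ : ∀ {A : Set} (us : List A) {w vs} → length (us ++ w ∷ vs) ≡ suc (length (us ++ vs))
length-++-∷ []       = refl
length-++-∷ (u ∷ us) = cong suc (length-++-∷ us)

injectiveOn⇒length≤ : ∀ {A B : Set} (f : A → B) {xs : List A} {ys : List B} → Unique xs →
  (∀ {x} → x List.∈ xs → f x List.∈ ys) →
  (∀ {x y} → x List.∈ xs → y List.∈ xs → f x ≡ f y → x ≡ y) →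
  length xs ≤ length ys
injectiveOn⇒length≤ f {[]}     _               _    _   = z≤n
injectiveOn⇒length≤ f {x ∷ xs} (x∉xs ∷ uniq) into inj with ∈-∃++ (into (here refl))
... | us , vs , refl = subst (suc (length xs) ≤_) (sym (length-++-∷ us))
  (s≤s (injectiveOn⇒length≤ f uniq into′ (λ a b → inj (there a) (there b))))
  where
  into′ : ∀ {a} → a List.∈ xs → f a List.∈ us ++ vs
  into′ a∈ = ∈-++-∷⁻ us (into (there a∈))
    (λ fa≡fx → All.lookup x∉xs a∈ (inj (here refl) (there a∈) (sym fa≡fx)))

Unique∧⊆⇒length≤ : ∀ {A : Set} {xs ys : List A} → Unique xs →
  (∀ {x} → x List.∈ xs → x List.∈ ys) → length xs ≤ length ys
Unique∧⊆⇒length≤ uniq xs⊆ys = injectiveOn⇒length≤ (λ x → x) uniq xs⊆ys (λ _ _ e → e)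

length-cartesianProduct : ∀ {A B : Set} (xs : List A) (ys : List B) →
  length (cartesianProduct xs ys) ≡ length xs * length ys
length-cartesianProduct []       ys = refl
length-cartesianProduct (x ∷ xs) ys = trans (length-++ (map (x ,_) ys))
  (cong₂ _+_ (length-map (x ,_) ys) (length-cartesianProduct xs ys))

-- Counting

module _ {n : ℕ} {P : Pred (Fin n) 0ℓ} (P? : Decidable P) where

  enumerate : List (Fin n)
  enumerate = filter P? (allFin n)

  enumerate-unique : Unique enumerate
  enumerate-unique = Unique.filter⁺ P? (Unique.allFin⁺ n)

  ∈-enumerate⁺ : ∀ {x} → P x → x List.∈ enumerate
  ∈-enumerate⁺ px = ∈-filter⁺ P? (∈-allFin _) px

  ∈-enumerate⁻ : ∀ {x} → x List.∈ enumerate → P x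
  ∈-enumerate⁻ x∈ = proj₂ (∈-filter⁻ P? {xs = allFin n} x∈)

countFin≡length-filter-tabulate : ∀ {n m} {P : Pred (Fin m) 0ℓ} (P? : Decidable P) (g : Fin n → Fin m) →
  countFin (λ x → P? (g x)) ≡ length (filter P? (tabulate g))
countFin≡length-filter-tabulate {zero}  P? g = refl
countFin≡length-filter-tabulate {suc n} P? g with P? (g zero)
... | yes _ = cong suc (countFin≡length-filter-tabulate P? (λ x → g (suc x)))
... | no _  = countFin≡length-filter-tabulate P? (λ x → g (suc x))

countFin≡ : ∀ {n} {P : Pred (Fin n) 0ℓ} (P? : Decidable P) → countFin P? ≡ length (enumerate P?)
countFin≡ P? = countFin≡length-filter-tabulate P? (λ x → x)

module _ {n m : ℕ} {P : Pred (Fin n) 0ℓ} {P′ : Pred (Fin m) 0ℓ} (P? : Decidable P) (P′? : Decidable P′) where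

  countFin-injection : (f : Fin n → Fin m) → (∀ {x} → P x → P′ (f x)) →
    (∀ {x y} → P x → P y → f x ≡ f y → x ≡ y) → countFin P? ≤ countFin P′?
  countFin-injection f into inj = subst₂ _≤_ (sym (countFin≡ P?)) (sym (countFin≡ P′?))
    (injectiveOn⇒length≤ f (enumerate-unique P?)
      (λ x∈ → ∈-enumerate⁺ P′? (into (∈-enumerate⁻ P? x∈)))
      (λ x∈ y∈ → inj (∈-enumerate⁻ P? x∈) (∈-enumerate⁻ P? y∈)))

module _ {n : ℕ} {P P′ : Pred (Fin n) 0ℓ} (P? : Decidable P) (P′? : Decidable P′) where

  countFin-mono : P ⊆ᵖ P′ → countFin P? ≤ countFin P′?
  countFin-mono P⊆P′ = countFin-injection P? P′? (λ x → x) P⊆P′ (λ _ _ e → e)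

  countFin-mono-< : P ⊆ᵖ P′ → ∀ {w} → P′ w → ¬ P w → countFin P? < countFin P′?
  countFin-mono-< P⊆P′ {w} p′w ¬pw = subst₂ _<_ (sym (countFin≡ P?)) (sym (countFin≡ P′?))
    (Unique∧⊆⇒length≤ (All.tabulate w≢ ∷ enumerate-unique P?) w∷P⊆P′)
    where
    w≢ : ∀ {x} → x List.∈ enumerate P? → w ≢ x
    w≢ x∈ refl = ¬pw (∈-enumerate⁻ P? x∈)
    w∷P⊆P′ : ∀ {x} → x List.∈ w ∷ enumerate P? → x List.∈ enumerate P′?
    w∷P⊆P′ (here refl) = ∈-enumerate⁺ P′? p′w
    w∷P⊆P′ (there x∈)  = ∈-enumerate⁺ P′? (P⊆P′ (∈-enumerate⁻ P? x∈))

  countFin-∪-≤ : countFin (P? ∪? P′?) ≤ countFin P? + countFin P′?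
  countFin-∪-≤ = subst₂ _≤_ (sym (countFin≡ (P? ∪? P′?)))
    (trans (length-++ (enumerate P?)) (cong₂ _+_ (sym (countFin≡ P?)) (sym (countFin≡ P′?))))
    (Unique∧⊆⇒length≤ (enumerate-unique (P? ∪? P′?)) into)
    where
    into : ∀ {x} → x List.∈ enumerate (P? ∪? P′?) → x List.∈ enumerate P? ++ enumerate P′?
    into x∈ with ∈-enumerate⁻ (P? ∪? P′?) x∈
    ... | inj₁ px  = ∈-++⁺ˡ (∈-enumerate⁺ P? px)
    ... | inj₂ p′x = ∈-++⁺ʳ (enumerate P?) (∈-enumerate⁺ P′? p′x)

  countFin-disjoint-∪ : (∀ {x} → P x → ¬ P′ x) → countFin P? + countFin P′? ≤ countFin (P? ∪? P′?)
  countFin-disjoint-∪ disjoint = subst₂ _≤_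
    (trans (length-++ (enumerate P?)) (cong₂ _+_ (sym (countFin≡ P?)) (sym (countFin≡ P′?))))
    (sym (countFin≡ (P? ∪? P′?)))
    (Unique∧⊆⇒length≤ (Unique.++⁺ (enumerate-unique P?) (enumerate-unique P′?) apart) into)
    where
    apart : ∀ {x} → ¬ (x List.∈ enumerate P? × x List.∈ enumerate P′?)
    apart (x∈P , x∈P′) = disjoint (∈-enumerate⁻ P? x∈P) (∈-enumerate⁻ P′? x∈P′)
    into : ∀ {x} → x List.∈ enumerate P? ++ enumerate P′? → x List.∈ enumerate (P? ∪? P′?)
    into x∈ with ∈-++⁻ (enumerate P?) x∈
    ... | inj₁ x∈P  = ∈-enumerate⁺ (P? ∪? P′?) (inj₁ (∈-enumerate⁻ P? x∈P))
    ... | inj₂ x∈P′ = ∈-enumerate⁺ (P? ∪? P′?) (inj₂ (∈-enumerate⁻ P′? x∈P′))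

countFin≤n : ∀ {n} {P : Pred (Fin n) 0ℓ} (P? : Decidable P) → countFin P? ≤ n
countFin≤n {n} P? = subst₂ _≤_ (sym (countFin≡ P?)) (length-tabulate (λ x → x))
  (Unique∧⊆⇒length≤ (enumerate-unique P?) (λ _ → ∈-allFin _))

countFin-cong : ∀ {n} {P P′ : Pred (Fin n) 0ℓ} (P? : Decidable P) (P′? : Decidable P′) →
  P ⊆ᵖ P′ → P′ ⊆ᵖ P → countFin P? ≡ countFin P′?
countFin-cong P? P′? P⊆P′ P′⊆P = ≤-antisym (countFin-mono P? P′? P⊆P′) (countFin-mono P′? P? P′⊆P)

∣p∣≡countFin∈ : ∀ {n} (p : Subset n) → ∣ p ∣ ≡ countFin (_∈? p)
∣p∣≡countFin∈ []           = refl
∣p∣≡countFin∈ (inside ∷ p)  = cong suc (trans (∣p∣≡countFin∈ p)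
  (countFin-cong (_∈? p) (λ x → suc x ∈? inside ∷ p) Vec.there drop-there))
∣p∣≡countFin∈ (outside ∷ p) = trans (∣p∣≡countFin∈ p)
  (countFin-cong (_∈? p) (λ x → suc x ∈? outside ∷ p) Vec.there drop-there)

module _ {n : ℕ} {P : Pred (Fin n) 0ℓ} (P? : Decidable P) where

  toSubset : Subset n
  toSubset = Vec.tabulate (λ x → does (P? x))

  ∈-toSubset⁺ : ∀ {x} → P x → x ∈ toSubset
  ∈-toSubset⁺ {x} px = lookup⇒[]= x toSubset (trans (lookup∘tabulate _ x) (decide (P? x)))
    where
    decide : (d : Dec (P x)) → does d ≡ true
    decide (yes _)  = refl
    decide (no ¬px) = ⊥-elim (¬px px)

  ∈-toSubset⁻ : ∀ {x} → x ∈ toSubset → P x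
  ∈-toSubset⁻ {x} x∈ = decide (P? x) (trans (sym (lookup∘tabulate _ x)) ([]=⇒lookup x∈))
    where
    decide : (d : Dec (P x)) → does d ≡ true → P x
    decide (yes px) _ = px

  ∣toSubset∣ : ∣ toSubset ∣ ≡ countFin P?
  ∣toSubset∣ = trans (∣p∣≡countFin∈ toSubset) (countFin-cong (_∈? toSubset) P? ∈-toSubset⁻ ∈-toSubset⁺)

subsetsOf : ∀ {n} → Subset n → List (Subset n)
subsetsOf []            = [] ∷ []
subsetsOf (inside ∷ Z)  = map (inside ∷_) (subsetsOf Z) ++ map (outside ∷_) (subsetsOf Z)
subsetsOf (outside ∷ Z) = map (outside ∷_) (subsetsOf Z)

length-subsetsOf : ∀ {n} (Z : Subset n) → length (subsetsOf Z) ≡ 2 ^ ∣ Z ∣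
length-subsetsOf []            = refl
length-subsetsOf (inside ∷ Z)  = trans (length-++ (map (inside ∷_) (subsetsOf Z)))
  (trans (cong₂ _+_ (length-map (inside ∷_) (subsetsOf Z)) (length-map (outside ∷_) (subsetsOf Z)))
    (cong₂ _+_ (length-subsetsOf Z) (trans (length-subsetsOf Z) (sym (+-identityʳ _)))))
length-subsetsOf (outside ∷ Z) = trans (length-map (outside ∷_) (subsetsOf Z)) (length-subsetsOf Z)

∈-subsetsOf : ∀ {n} {W Z : Subset n} → W ⊆ Z → W List.∈ subsetsOf Z
∈-subsetsOf {W = []}          {[]}          _    = here refl
∈-subsetsOf {W = inside ∷ W}  {inside ∷ Z}  W⊆Z  = ∈-++⁺ˡ (∈-map⁺ (inside ∷_) (∈-subsetsOf (drop-∷-⊆ W⊆Z)))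
∈-subsetsOf {W = outside ∷ W} {inside ∷ Z}  W⊆Z  =
  ∈-++⁺ʳ (map (inside ∷_) (subsetsOf Z)) (∈-map⁺ (outside ∷_) (∈-subsetsOf (drop-∷-⊆ W⊆Z)))
∈-subsetsOf {W = inside ∷ W}  {outside ∷ Z} W⊆Z  with W⊆Z Vec.here
... | ()
∈-subsetsOf {W = outside ∷ W} {outside ∷ Z} W⊆Z  = ∈-map⁺ (outside ∷_) (∈-subsetsOf (drop-∷-⊆ W⊆Z))

∩-injectiveOn⇒length≤2^∣∣ : ∀ {n} (Z : Subset n) {Fs : List (Subset n)} → Unique Fs →
  (∀ {S T} → S List.∈ Fs → T List.∈ Fs → S ∩ₛ Z ≡ T ∩ₛ Z → S ≡ T) → length Fs ≤ 2 ^ ∣ Z ∣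
∩-injectiveOn⇒length≤2^∣∣ Z uniq inj = subst (_ ≤_) (length-subsetsOf Z)
  (injectiveOn⇒length≤ (_∩ₛ Z) uniq (λ {S} _ → ∈-subsetsOf (p∩q⊆q S Z)) inj)

∩≡∩⇒∈⇔ : ∀ {n} {S T Z : Subset n} {x} → S ∩ₛ Z ≡ T ∩ₛ Z → x ∈ Z → x ∈ S ⇔ x ∈ T
∩≡∩⇒∈⇔ {S = S} {T} {Z} eq x∈Z = mk⇔
  (λ x∈S → proj₁ (x∈p∩q⁻ T Z (subst (_ ∈_) eq (x∈p∩q⁺ (x∈S , x∈Z)))))
  (λ x∈T → proj₁ (x∈p∩q⁻ S Z (subst (_ ∈_) (sym eq) (x∈p∩q⁺ (x∈T , x∈Z)))))

allSubsets-unique : ∀ n → Unique (allSubsets n)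
allSubsets-unique zero    = [] ∷ []
allSubsets-unique (suc n) = Unique.++⁺ (Unique.map⁺ ∷-injectiveʳ (allSubsets-unique n))
  (Unique.map⁺ ∷-injectiveʳ (allSubsets-unique n)) heads-differ
  where
  ∷-injectiveʳ : ∀ {s} {p q : Subset n} → _≡_ {A = Subset (suc n)} (s ∷ p) (s ∷ q) → p ≡ q
  ∷-injectiveʳ refl = refl
  heads-differ : ∀ {S} → ¬ (S List.∈ map (inside ∷_) (allSubsets n) × S List.∈ map (outside ∷_) (allSubsets n))
  heads-differ (S∈ , S∈′) with ∈-map⁻ (inside ∷_) S∈ | ∈-map⁻ (outside ∷_) S∈′
  ... | _ , _ , refl | _ , _ , ()

-- Least elements of equivalence classes

least-witness : ∀ {n} {P : Pred (Fin n) 0ℓ} → Decidable P → ∀ {w} → P w →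
  Σ (Fin n) λ a → P a × (∀ b → b <ᶠ a → ¬ P b)
least-witness {suc n} P? {w} pw with P? zero
... | yes p0 = zero , p0 , λ _ ()
least-witness {suc n} P? {zero}  pw | no ¬p0 = ⊥-elim (¬p0 pw)
least-witness {suc n} P? {suc w} pw | no ¬p0 with least-witness (λ x → P? (suc x)) pw
... | a , pa , below = suc a , pa , below′
  where
  below′ : ∀ b → b <ᶠ suc a → ¬ _
  below′ zero    _         = ¬p0
  below′ (suc b) (s≤s b<a) = below b b<a

module ClassMinimum {n : ℕ} {_~_ : Rel (Fin n) 0ℓ}
  (~-isEquivalence : IsEquivalence _~_) (_~?_ : B.Decidable _~_) where

  open IsEquivalence ~-isEquivalence renaming (refl to ~-refl; sym to ~-sym; trans to ~-trans)

  IsMinimal : Pred (Fin n) 0ℓ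
  IsMinimal x = ∀ y → y <ᶠ x → ¬ x ~ y

  isMinimal? : Decidable IsMinimal
  isMinimal? x = all? (λ y → (y <? x) →-dec ¬? (x ~? y))

  minimal-unique : ∀ {x y} → IsMinimal x → IsMinimal y → x ~ y → x ≡ y
  minimal-unique {x} {y} min-x min-y x~y with <-cmp x y
  ... | tri< x<y _ _ = ⊥-elim (min-y x x<y (~-sym x~y))
  ... | tri≈ _ x≡y _ = x≡y
  ... | tri> _ _ y<x = ⊥-elim (min-x y y<x x~y)

  private
    leastInClass : ∀ x → Σ (Fin n) λ a → x ~ a × (∀ b → b <ᶠ a → ¬ x ~ b)
    leastInClass x = least-witness (x ~?_) ~-refl

  min : Fin n → Fin n
  min x = proj₁ (leastInClass x)

  ~-min : ∀ x → x ~ min x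
  ~-min x = proj₁ (proj₂ (leastInClass x))

  min-minimal : ∀ x → IsMinimal (min x)
  min-minimal x b b<min min~b = proj₂ (proj₂ (leastInClass x)) b b<min (~-trans (~-min x) min~b)

  min-cong : ∀ {x y} → x ~ y → min x ≡ min y
  min-cong {x} {y} x~y = minimal-unique (min-minimal x) (min-minimal y)
    (~-trans (~-sym (~-min x)) (~-trans x~y (~-min y)))

  min-injective : ∀ {x y} → min x ≡ min y → x ~ y
  min-injective {x} {y} eq = ~-trans (~-min x) (subst (_~ y) (sym eq) (~-sym (~-min y)))

-- Right and double cosets

module Cosets {n : ℕ} (R : FinGroup n) (Q : Subset n) (sg : IsSubgroup R Q) where

  open FinGroup R
  open IsSubgroup sg
  open IsGroup isGroup using (assoc; identityˡ; identityʳ; inverseˡ; inverseʳ)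

  group : Group 0ℓ 0ℓ
  group = record { isGroup = isGroup }

  open GroupProperties group using (⁻¹-involutive; ⁻¹-anti-homo-∙)

  infix 4 _≈ʳ_ _≈ᵈ_

  _≈ʳ_ : Rel (Fin n) 0ℓ
  x ≈ʳ y = InRightCoset R Q x y

  _≈ᵈ_ : Rel (Fin n) 0ℓ
  x ≈ᵈ y = InDoubleCoset R Q x y

  ≈ʳ-refl : ∀ {x} → x ≈ʳ x
  ≈ʳ-refl {x} = ε , ε∈ , sym (identityˡ x)

  ≈ʳ-sym : ∀ {x y} → x ≈ʳ y → y ≈ʳ x
  ≈ʳ-sym {x} (q , q∈ , refl) = q ⁻¹ , ⁻¹-closed q∈ , (begin
    x               ≡⟨ sym (identityˡ x) ⟩
    ε ∙ x           ≡⟨ cong (_∙ x) (sym (inverseˡ q)) ⟩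
    q ⁻¹ ∙ q ∙ x    ≡⟨ assoc _ _ _ ⟩
    q ⁻¹ ∙ (q ∙ x)  ∎)
    where open ≡-Reasoning

  ≈ʳ-trans : ∀ {x y z} → x ≈ʳ y → y ≈ʳ z → x ≈ʳ z
  ≈ʳ-trans (q , q∈ , refl) (q′ , q′∈ , refl) = q′ ∙ q , ∙-closed q′∈ q∈ , sym (assoc _ _ _)

  ≈ᵈ-refl : ∀ {x} → x ≈ᵈ x
  ≈ᵈ-refl {x} = ε , ε , ε∈ , ε∈ , sym (trans (identityʳ _) (identityˡ x))

  ≈ᵈ-sym : ∀ {x y} → x ≈ᵈ y → y ≈ᵈ x
  ≈ᵈ-sym {x} (q , q′ , q∈ , q′∈ , refl) = q ⁻¹ , q′ ⁻¹ , ⁻¹-closed q∈ , ⁻¹-closed q′∈ , (begin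
    x                            ≡⟨ sym (identityʳ x) ⟩
    x ∙ ε                        ≡⟨ cong (x ∙_) (sym (inverseʳ q′)) ⟩
    x ∙ (q′ ∙ q′ ⁻¹)             ≡⟨ sym (assoc _ _ _) ⟩
    x ∙ q′ ∙ q′ ⁻¹               ≡⟨ cong (λ t → t ∙ q′ ∙ q′ ⁻¹) (sym (identityˡ x)) ⟩
    ε ∙ x ∙ q′ ∙ q′ ⁻¹           ≡⟨ cong (λ t → t ∙ x ∙ q′ ∙ q′ ⁻¹) (sym (inverseˡ q)) ⟩
    q ⁻¹ ∙ q ∙ x ∙ q′ ∙ q′ ⁻¹    ≡⟨ cong (λ t → t ∙ q′ ∙ q′ ⁻¹) (assoc _ _ _) ⟩
    q ⁻¹ ∙ (q ∙ x) ∙ q′ ∙ q′ ⁻¹  ≡⟨ cong (_∙ q′ ⁻¹) (assoc _ _ _) ⟩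
    q ⁻¹ ∙ (q ∙ x ∙ q′) ∙ q′ ⁻¹  ∎)
    where open ≡-Reasoning

  ≈ᵈ-trans : ∀ {x y z} → x ≈ᵈ y → y ≈ᵈ z → x ≈ᵈ z
  ≈ᵈ-trans {x} (q , q′ , q∈ , q′∈ , refl) (p , p′ , p∈ , p′∈ , refl) =
    p ∙ q , q′ ∙ p′ , ∙-closed p∈ q∈ , ∙-closed q′∈ p′∈ , (begin
      p ∙ (q ∙ x ∙ q′) ∙ p′  ≡⟨ cong (_∙ p′) (sym (assoc _ _ _)) ⟩
      p ∙ (q ∙ x) ∙ q′ ∙ p′  ≡⟨ cong (λ t → t ∙ q′ ∙ p′) (sym (assoc _ _ _)) ⟩
      p ∙ q ∙ x ∙ q′ ∙ p′    ≡⟨ assoc _ _ _ ⟩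
      p ∙ q ∙ x ∙ (q′ ∙ p′)  ∎)
    where open ≡-Reasoning

  ≈ʳ⇒≈ᵈ : ∀ {x y} → x ≈ʳ y → x ≈ᵈ y
  ≈ʳ⇒≈ᵈ (q , q∈ , refl) = q , ε , q∈ , ε∈ , sym (identityʳ _)

  ≈ᵈ-⁻¹ : ∀ {x y} → x ≈ᵈ y → x ⁻¹ ≈ᵈ y ⁻¹
  ≈ᵈ-⁻¹ {x} (q , q′ , q∈ , q′∈ , refl) = q′ ⁻¹ , q ⁻¹ , ⁻¹-closed q′∈ , ⁻¹-closed q∈ , (begin
    (q ∙ x ∙ q′) ⁻¹         ≡⟨ ⁻¹-anti-homo-∙ _ _ ⟩
    q′ ⁻¹ ∙ (q ∙ x) ⁻¹      ≡⟨ cong (q′ ⁻¹ ∙_) (⁻¹-anti-homo-∙ _ _) ⟩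
    q′ ⁻¹ ∙ (x ⁻¹ ∙ q ⁻¹)   ≡⟨ sym (assoc _ _ _) ⟩
    q′ ⁻¹ ∙ x ⁻¹ ∙ q ⁻¹     ∎)
    where open ≡-Reasoning

  ≈ᵈ-⁻¹ʳ : ∀ {x y} → x ≈ᵈ y ⁻¹ → x ⁻¹ ≈ᵈ y
  ≈ᵈ-⁻¹ʳ {y = y} x≈y⁻¹ = subst (_ ≈ᵈ_) (⁻¹-involutive y) (≈ᵈ-⁻¹ x≈y⁻¹)

  ≈ʳ⇒∙⁻¹∈ : ∀ {x y} → x ≈ʳ y → x ∙ y ⁻¹ ∈ Q
  ≈ʳ⇒∙⁻¹∈ {x} (q , q∈ , refl) = subst (_∈ Q) (sym x[qx]⁻¹≡q⁻¹) (⁻¹-closed q∈)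
    where
    open ≡-Reasoning
    x[qx]⁻¹≡q⁻¹ : x ∙ (q ∙ x) ⁻¹ ≡ q ⁻¹
    x[qx]⁻¹≡q⁻¹ = begin
      x ∙ (q ∙ x) ⁻¹      ≡⟨ cong (x ∙_) (⁻¹-anti-homo-∙ q x) ⟩
      x ∙ (x ⁻¹ ∙ q ⁻¹)   ≡⟨ sym (assoc _ _ _) ⟩
      x ∙ x ⁻¹ ∙ q ⁻¹     ≡⟨ cong (_∙ q ⁻¹) (inverseʳ x) ⟩
      ε ∙ q ⁻¹            ≡⟨ identityˡ _ ⟩
      q ⁻¹                ∎

  ≈ʳ-isEquivalence : IsEquivalence _≈ʳ_
  ≈ʳ-isEquivalence = record { refl = ≈ʳ-refl ; sym = ≈ʳ-sym ; trans = ≈ʳ-trans }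

  ≈ᵈ-isEquivalence : IsEquivalence _≈ᵈ_
  ≈ᵈ-isEquivalence = record { refl = ≈ᵈ-refl ; sym = ≈ᵈ-sym ; trans = ≈ᵈ-trans }

  module Right  = ClassMinimum ≈ʳ-isEquivalence (inRightCoset? R Q)
  module Double = ClassMinimum ≈ᵈ-isEquivalence (inDoubleCoset? R Q)

  x∙y⁻¹∙y≡x : ∀ x y → x ∙ y ⁻¹ ∙ y ≡ x
  x∙y⁻¹∙y≡x x y = trans (assoc _ _ _) (trans (cong (x ∙_) (inverseˡ y)) (identityʳ x))

  n≤∣Q∣*#rightCosets : n ≤ ∣ Q ∣ * countFin Right.isMinimal?
  n≤∣Q∣*#rightCosets = subst₂ _≤_ (length-tabulate (λ x → x))
    (trans (length-cartesianProduct (enumerate (_∈? Q)) (enumerate Right.isMinimal?))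
      (sym (cong₂ _*_ (trans (∣p∣≡countFin∈ Q) (countFin≡ (_∈? Q))) (countFin≡ Right.isMinimal?))))
    (injectiveOn⇒length≤ split (Unique.allFin⁺ n) into inj)
    where
    split : Fin n → Fin n × Fin n
    split y = y ∙ Right.min y ⁻¹ , Right.min y
    into : ∀ {y} → y List.∈ allFin n →
      split y List.∈ cartesianProduct (enumerate (_∈? Q)) (enumerate Right.isMinimal?)
    into {y} _ = ∈-cartesianProduct⁺ (∈-enumerate⁺ (_∈? Q) (≈ʳ⇒∙⁻¹∈ (Right.~-min y)))
      (∈-enumerate⁺ Right.isMinimal? (Right.min-minimal y))
    inj : ∀ {y z} → y List.∈ allFin n → z List.∈ allFin n → split y ≡ split z → y ≡ z
    inj {y} {z} _ _ eq = trans (sym (x∙y⁻¹∙y≡x y (Right.min y)))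
      (trans (cong₂ _∙_ (cong proj₁ eq) (cong proj₂ eq)) (x∙y⁻¹∙y≡x z (Right.min z)))

  index≤#rightCosets : index R Q sg ≤ countFin Right.isMinimal?
  index≤#rightCosets = ≤-trans (/-monoˡ-≤ ∣ Q ∣ n≤∣Q∣*#rightCosets)
    (≤-reflexive (trans (cong (_/ ∣ Q ∣) (*-comm ∣ Q ∣ _)) (m*n/n≡m _ ∣ Q ∣)))
    where
    instance
      ∣Q∣-nonZero : NonZero ∣ Q ∣
      ∣Q∣-nonZero = >-nonZero (≤-<-trans z≤n (x∈p⇒∣p-x∣<∣p∣ ε∈))

  NonLeading : Pred (Fin n) 0ℓ
  NonLeading x = Right.IsMinimal x × ¬ Double.IsMinimal x

  nonLeading? : Decidable NonLeading
  nonLeading? x = Right.isMinimal? x ×-dec ¬? (Double.isMinimal? x)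

  #rightCosets≤#nonLeading+#doubleCosets :
    countFin Right.isMinimal? ≤ countFin nonLeading? + numDoubleCosets R Q
  #rightCosets≤#nonLeading+#doubleCosets =
    ≤-trans (countFin-mono Right.isMinimal? (nonLeading? ∪? Double.isMinimal?) split)
            (countFin-∪-≤ nonLeading? Double.isMinimal?)
    where
    split : Right.IsMinimal ⊆ᵖ NonLeading ∪ Double.IsMinimal
    split {x} rmin with Double.isMinimal? x
    ... | yes dmin = inj₂ dmin
    ... | no ¬dmin = inj₁ (rmin , ¬dmin)

  Double⇒Right-minimal : ∀ {x} → Double.IsMinimal x → Right.IsMinimal x
  Double⇒Right-minimal dmin y y<x x≈y = dmin y y<x (≈ʳ⇒≈ᵈ x≈y)

  SelfPaired : Pred (Fin n) 0ℓ
  SelfPaired x = x ≈ᵈ x ⁻¹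

  -- If x⁻¹ = q x q′ then (q′ x)⁻¹ = q x, so q′ x and its inverse both lie in Q x.
  pivotOf : ∀ x → Dec (SelfPaired x) → Σ (Fin n) λ y → x ≈ʳ y × (SelfPaired x → x ≈ʳ y ⁻¹)
  pivotOf x (no ¬sp) = x , ≈ʳ-refl , λ sp → ⊥-elim (¬sp sp)
  pivotOf x (yes (q , q′ , q∈ , q′∈ , x⁻¹≡qxq′)) = q′ ∙ x , (q′ , q′∈ , refl) , λ _ → q , q∈ , (begin
    (q′ ∙ x) ⁻¹          ≡⟨ ⁻¹-anti-homo-∙ _ _ ⟩
    x ⁻¹ ∙ q′ ⁻¹         ≡⟨ cong (_∙ q′ ⁻¹) x⁻¹≡qxq′ ⟩
    q ∙ x ∙ q′ ∙ q′ ⁻¹   ≡⟨ assoc _ _ _ ⟩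
    q ∙ x ∙ (q′ ∙ q′ ⁻¹) ≡⟨ cong (q ∙ x ∙_) (inverseʳ q′) ⟩
    q ∙ x ∙ ε            ≡⟨ identityʳ _ ⟩
    q ∙ x                ∎)
    where open ≡-Reasoning

  pivot : Fin n → Fin n
  pivot x = proj₁ (pivotOf x (inDoubleCoset? R Q x (x ⁻¹)))

  ≈ʳ-pivot : ∀ x → x ≈ʳ pivot x
  ≈ʳ-pivot x = proj₁ (proj₂ (pivotOf x (inDoubleCoset? R Q x (x ⁻¹))))

  ≈ʳ-pivot⁻¹ : ∀ {x} → SelfPaired x → x ≈ʳ pivot x ⁻¹
  ≈ʳ-pivot⁻¹ {x} = proj₂ (proj₂ (pivotOf x (inDoubleCoset? R Q x (x ⁻¹))))

  𝓛 : List (Subset n)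
  𝓛 = filter (λ S → inverseClosed? R S ×-dec evenly? R Q S) (allSubsets n)

  𝓛-unique : Unique 𝓛
  𝓛-unique = Unique.filter⁺ _ (allSubsets-unique n)

  ∈-𝓛⁻ : ∀ {S} → S List.∈ 𝓛 → InL R Q S
  ∈-𝓛⁻ S∈ = proj₂ (∈-filter⁻ (λ S → inverseClosed? R S ×-dec evenly? R Q S) {xs = allSubsets n} S∈)

  module Selection {_⊑_ : Rel (Fin n) 0ℓ} (⊑-isDecTotalOrder : B.IsDecTotalOrder _≡_ _⊑_) where

    open B.IsDecTotalOrder ⊑-isDecTotalOrder using (antisym; total) renaming (_≤?_ to _⊑?_)

    Selected : Pred (Fin n) 0ℓ
    Selected x = NonLeading x × Double.min x ⊑ Double.min (x ⁻¹)

    selected? : Decidable Selected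
    selected? x = nonLeading? x ×-dec (Double.min x ⊑? Double.min (x ⁻¹))

    selected-≈ᵈ⁻¹⇒selfPaired : ∀ {x y} → Selected x → Selected y → x ≈ᵈ y ⁻¹ → SelfPaired y
    selected-≈ᵈ⁻¹⇒selfPaired {y = y} (_ , x⊑x⁻¹) (_ , y⊑y⁻¹) x≈y⁻¹ =
      Double.min-injective (antisym y⊑y⁻¹ y⁻¹⊑y)
      where
      y⁻¹⊑y : Double.min (y ⁻¹) ⊑ Double.min y
      y⁻¹⊑y = subst₂ _⊑_ (Double.min-cong x≈y⁻¹) (Double.min-cong (≈ᵈ-⁻¹ʳ x≈y⁻¹)) x⊑x⁻¹

    InPair : Fin n → Pred (Fin n) 0ℓ
    InPair x z = z ≡ pivot x ⊎ z ≡ pivot x ⁻¹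

    inPair-⁻¹ : ∀ {x z} → InPair x z → InPair x (z ⁻¹)
    inPair-⁻¹ (inj₁ refl) = inj₂ refl
    inPair-⁻¹ (inj₂ refl) = inj₁ (⁻¹-involutive _)

    Marked : Pred (Fin n) 0ℓ
    Marked z = Σ (Fin n) λ x → Selected x × InPair x z

    marked? : Decidable Marked
    marked? z = any? (λ x → selected? x ×-dec ((z ≟ pivot x) ⊎-dec (z ≟ pivot x ⁻¹)))

    unmarked-⁻¹ : ∀ {z} → ¬ Marked z → ¬ Marked (z ⁻¹)
    unmarked-⁻¹ {z} ¬m (x , sel , pair) = ¬m (x , sel , subst (InPair x) (⁻¹-involutive z) (inPair-⁻¹ pair))

    ≈ʳ-inPair : ∀ {x z w} → InPair x z → w ≈ʳ z → w ≈ʳ x ⊎ (¬ SelfPaired x × w ≈ᵈ x ⁻¹)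
    ≈ʳ-inPair {x} (inj₁ refl) w≈z = inj₁ (≈ʳ-trans w≈z (≈ʳ-sym (≈ʳ-pivot x)))
    ≈ʳ-inPair {x} {w = w} (inj₂ refl) w≈z = decide (inDoubleCoset? R Q x (x ⁻¹))
      where
      decide : Dec (SelfPaired x) → w ≈ʳ x ⊎ (¬ SelfPaired x × w ≈ᵈ x ⁻¹)
      decide (yes sp) = inj₁ (≈ʳ-trans w≈z (≈ʳ-sym (≈ʳ-pivot⁻¹ sp)))
      decide (no ¬sp) = inj₂ (¬sp , ≈ᵈ-trans (≈ʳ⇒≈ᵈ w≈z) (≈ᵈ-sym (≈ᵈ-⁻¹ (≈ʳ⇒≈ᵈ (≈ʳ-pivot x)))))

    selected-≈ʳ-inPair : ∀ {x y z} → Selected x → Selected y → InPair y z → x ≈ʳ z → x ≡ y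
    selected-≈ʳ-inPair selX selY pair x≈z with ≈ʳ-inPair pair x≈z
    ... | inj₁ x≈y = Right.minimal-unique (proj₁ (proj₁ selX)) (proj₁ (proj₁ selY)) x≈y
    ... | inj₂ (¬sp , x≈y⁻¹) = ⊥-elim (¬sp (selected-≈ᵈ⁻¹⇒selfPaired selX selY x≈y⁻¹))

    inPair-unique : ∀ {x y z} → Selected x → Selected y → InPair x z → InPair y z → x ≡ y
    inPair-unique {x} selX selY (inj₁ refl) pairY = selected-≈ʳ-inPair selX selY pairY (≈ʳ-pivot x)
    inPair-unique {x} selX selY (inj₂ refl) pairY = selected-≈ʳ-inPair selX selY
      (subst (InPair _) (⁻¹-involutive (pivot x)) (inPair-⁻¹ pairY)) (≈ʳ-pivot x)

    ≈ʳ-min-unmarked : ∀ {x z} → Selected x → Double.min x ≈ʳ z → ¬ Marked z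
    ≈ʳ-min-unmarked {x} selX d≈z (y , selY@((ymin , ¬y-dmin) , _) , pair) with ≈ʳ-inPair pair d≈z
    ... | inj₁ d≈y = ¬y-dmin (subst Double.IsMinimal
      (Right.minimal-unique (Double⇒Right-minimal (Double.min-minimal x)) ymin d≈y) (Double.min-minimal x))
    ... | inj₂ (¬sp , d≈y⁻¹) = ¬sp (selected-≈ᵈ⁻¹⇒selfPaired selX selY (≈ᵈ-trans (Double.~-min x) d≈y⁻¹))

    module _ {S : Subset n} (closed : InverseClosed R S) where

      inPair-∈ : ∀ {x z} → InPair x z → z ∈ S → pivot x ∈ S
      inPair-∈ (inj₁ refl) z∈S = z∈S
      inPair-∈ (inj₂ refl) z∈S = Equivalence.from (closed _) z∈S

      ∈-inPair : ∀ {x z} → InPair x z → pivot x ∈ S → z ∈ S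
      ∈-inPair (inj₁ refl) p∈S = p∈S
      ∈-inPair (inj₂ refl) p∈S = Equivalence.to (closed _) p∈S

    AgreeOffMarks : Subset n → Subset n → Set
    AgreeOffMarks S T = ∀ {z} → ¬ Marked z → z ∈ S ⇔ z ∈ T

    pivot-∈ : ∀ {S T x} → InL R Q S → InL R Q T → AgreeOffMarks S T →
      Selected x → pivot x ∈ S → pivot x ∈ T
    pivot-∈ {S} {T} {x} (_ , evenS) (closedT , evenT) agree selX p∈S with pivot x ∈? T
    ... | yes p∈T = p∈T
    ... | no p∉T  = ⊥-elim (<-irrefl same-card fewer)
      where
      open ≡-Reasoning
      card : Subset n → Fin n → ℕ
      card = cardInterRightCoset R Q
      d : Fin n
      d = Double.min x
      T∩Qx⊆S∩Qx : (λ z → z ∈ T × x ≈ʳ z) ⊆ᵖ (λ z → z ∈ S × x ≈ʳ z)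
      T∩Qx⊆S∩Qx {z} (z∈T , x≈z) with marked? z
      ... | no ¬m = Equivalence.from (agree ¬m) z∈T , x≈z
      ... | yes (y , selY , pair) = ⊥-elim (p∉T (inPair-∈ closedT pairX z∈T))
        where
        pairX : InPair x z
        pairX = subst (λ t → InPair t z) (sym (selected-≈ʳ-inPair selX selY pair x≈z)) pair
      fewer : card T x < card S x
      fewer = countFin-mono-< ((_∈? T) ∩? inRightCoset? R Q x) ((_∈? S) ∩? inRightCoset? R Q x)
        T∩Qx⊆S∩Qx (p∈S , ≈ʳ-pivot x) (λ (p∈T , _) → p∉T p∈T)
      same-card : card T x ≡ card S x
      same-card = begin
        card T x ≡⟨ evenT x x d ≈ᵈ-refl (Double.~-min x) ⟩
        card T d ≡⟨ countFin-cong ((_∈? T) ∩? inRightCoset? R Q d) ((_∈? S) ∩? inRightCoset? R Q d)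
                      (λ (z∈T , d≈z) → Equivalence.from (agree (≈ʳ-min-unmarked selX d≈z)) z∈T , d≈z)
                      (λ (z∈S , d≈z) → Equivalence.to (agree (≈ʳ-min-unmarked selX d≈z)) z∈S , d≈z) ⟩
        card S d ≡⟨ sym (evenS x x d ≈ᵈ-refl (Double.~-min x)) ⟩
        card S x ∎

    offMarks-⊆ : ∀ {S T} → InL R Q S → InL R Q T → AgreeOffMarks S T → S ⊆ T
    offMarks-⊆ LS LT agree {z} z∈S with marked? z
    ... | no ¬m = Equivalence.to (agree ¬m) z∈S
    ... | yes (x , selX , pair) =
      ∈-inPair (proj₁ LT) pair (pivot-∈ LS LT agree selX (inPair-∈ (proj₁ LS) pair z∈S))

    offMarks-determines : ∀ {S T} → InL R Q S → InL R Q T → AgreeOffMarks S T → S ≡ T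
    offMarks-determines LS LT agree =
      ⊆-antisym (offMarks-⊆ LS LT agree) (offMarks-⊆ LT LS (λ ¬m → ⇔.sym (agree ¬m)))

    Lower : Pred (Fin n) 0ℓ
    Lower y = y ⊑ (y ⁻¹)

    lower? : Decidable Lower
    lower? y = y ⊑? (y ⁻¹)

    lower⊎lower⁻¹ : ∀ y → Lower y ⊎ Lower (y ⁻¹)
    lower⊎lower⁻¹ y with total y (y ⁻¹)
    ... | inj₁ y⊑y⁻¹ = inj₁ y⊑y⁻¹
    ... | inj₂ y⁻¹⊑y = inj₂ (subst ((y ⁻¹) ⊑_) (sym (⁻¹-involutive y)) y⁻¹⊑y)

    free? : Decidable (Lower ∩ ∁ Marked)
    free? = lower? ∩? ∁? marked?

    lowerMarked? : Decidable (Lower ∩ Marked)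
    lowerMarked? = lower? ∩? marked?

    ∩free-injective : ∀ {S T} → InL R Q S → InL R Q T →
      S ∩ₛ toSubset free? ≡ T ∩ₛ toSubset free? → S ≡ T
    ∩free-injective {S} {T} LS LT eq = offMarks-determines LS LT agree
      where
      agree : AgreeOffMarks S T
      agree {z} ¬m with lower⊎lower⁻¹ z
      ... | inj₁ low = ∩≡∩⇒∈⇔ eq (∈-toSubset⁺ free? (low , ¬m))
      ... | inj₂ low⁻¹ = ⇔.trans (proj₁ LS z) (⇔.trans
        (∩≡∩⇒∈⇔ eq (∈-toSubset⁺ free? (low⁻¹ , unmarked-⁻¹ ¬m))) (⇔.sym (proj₁ LT z)))

    cardL≤2^#free : cardL R Q ≤ 2 ^ countFin free?
    cardL≤2^#free = subst (λ k → cardL R Q ≤ 2 ^ k) (∣toSubset∣ free?)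
      (∩-injectiveOn⇒length≤2^∣∣ (toSubset free?) 𝓛-unique
        (λ S∈ T∈ → ∩free-injective (∈-𝓛⁻ S∈) (∈-𝓛⁻ T∈)))

    lowerInPair : ∀ x → Σ (Fin n) λ z → InPair x z × Lower z
    lowerInPair x with lower⊎lower⁻¹ (pivot x)
    ... | inj₁ low   = pivot x , inj₁ refl , low
    ... | inj₂ low⁻¹ = pivot x ⁻¹ , inj₂ refl , low⁻¹

    #selected≤#lowerMarked : countFin selected? ≤ countFin lowerMarked?
    #selected≤#lowerMarked = countFin-injection selected? lowerMarked? (λ x → proj₁ (lowerInPair x))
      (λ {x} selX → proj₂ (proj₂ (lowerInPair x)) , x , selX , proj₁ (proj₂ (lowerInPair x)))
      (λ {x} {y} selX selY eq → inPair-unique selX selY (proj₁ (proj₂ (lowerInPair x)))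
        (subst (InPair y) (sym eq) (proj₁ (proj₂ (lowerInPair y)))))

    #free+#lowerMarked≤#lower : countFin free? + countFin lowerMarked? ≤ countFin lower?
    #free+#lowerMarked≤#lower = ≤-trans
      (countFin-disjoint-∪ free? lowerMarked? (λ (_ , ¬m) (_ , m) → ¬m m))
      (countFin-mono (free? ∪? lowerMarked?) lower? [ proj₁ , proj₁ ])

    cardL*2^#selected≤2^#lower : cardL R Q * 2 ^ countFin selected? ≤ 2 ^ countFin lower?
    cardL*2^#selected≤2^#lower = ≤-trans
      (*-mono-≤ cardL≤2^#free (^-monoʳ-≤ 2 #selected≤#lowerMarked))
      (≤-trans (≤-reflexive (sym (^-distribˡ-+-* 2 (countFin free?) (countFin lowerMarked?))))
        (^-monoʳ-≤ 2 #free+#lowerMarked≤#lower))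

  module Ascending  = Selection ≤-isDecTotalOrder
  module Descending = Selection (Flip.isDecTotalOrder ≤-isDecTotalOrder)

  #nonLeading≤#ascending+#descending :
    countFin nonLeading? ≤ countFin Ascending.selected? + countFin Descending.selected?
  #nonLeading≤#ascending+#descending =
    ≤-trans (countFin-mono nonLeading? (Ascending.selected? ∪? Descending.selected?) orient)
            (countFin-∪-≤ Ascending.selected? Descending.selected?)
    where
    orient : NonLeading ⊆ᵖ Ascending.Selected ∪ Descending.Selected
    orient {x} nl with ≤-total (Double.min x) (Double.min (x ⁻¹))
    ... | inj₁ x≤x⁻¹ = inj₁ (nl , x≤x⁻¹)
    ... | inj₂ x⁻¹≤x = inj₂ (nl , x⁻¹≤x)

  #lowerAscending+#lowerDescending≤n+#involutions :
    countFin Ascending.lower? + countFin Descending.lower? ≤ n + numInvolutions R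
  #lowerAscending+#lowerDescending≤n+#involutions = begin
    countFin up? + countFin down?                        ≤⟨ +-monoʳ-≤ (countFin up?) #down≤ ⟩
    countFin up? + (countFin onlyDown? + countFin inv?)  ≡⟨ +-assoc (countFin up?) _ _ ⟨
    countFin up? + countFin onlyDown? + countFin inv?    ≤⟨ +-monoˡ-≤ (countFin inv?) #up+#onlyDown≤n ⟩
    n + numInvolutions R                                 ∎
    where
    open ≤-Reasoning
    up? : Decidable Ascending.Lower
    up? = Ascending.lower?
    down? : Decidable Descending.Lower
    down? = Descending.lower?
    onlyDown? : Decidable (Descending.Lower ∩ ∁ Ascending.Lower)
    onlyDown? = down? ∩? ∁? up?
    inv? : Decidable (λ x → x ∙ x ≡ ε)
    inv? x = (x ∙ x) ≟ ε
    #down≤ : countFin down? ≤ countFin onlyDown? + countFin inv?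
    #down≤ = ≤-trans (countFin-mono down? (onlyDown? ∪? inv?) split) (countFin-∪-≤ onlyDown? inv?)
      where
      split : Descending.Lower ⊆ᵖ (Descending.Lower ∩ ∁ Ascending.Lower) ∪ (λ x → x ∙ x ≡ ε)
      split {x} x⁻¹≤x with up? x
      ... | no x≰x⁻¹ = inj₁ (x⁻¹≤x , x≰x⁻¹)
      ... | yes x≤x⁻¹ = inj₂ (trans (cong (x ∙_) (≤ᶠ-antisym x≤x⁻¹ x⁻¹≤x)) (inverseʳ x))
    #up+#onlyDown≤n : countFin up? + countFin onlyDown? ≤ n
    #up+#onlyDown≤n = ≤-trans (countFin-disjoint-∪ up? onlyDown? (λ up (_ , ¬up) → ¬up up))
                              (countFin≤n (up? ∪? onlyDown?))

  index≤#ascending+#descending+#doubleCosets :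
    index R Q sg ≤ countFin Ascending.selected? + countFin Descending.selected? + numDoubleCosets R Q
  index≤#ascending+#descending+#doubleCosets = ≤-trans index≤#rightCosets
    (≤-trans #rightCosets≤#nonLeading+#doubleCosets (+-monoˡ-≤ _ #nonLeading≤#ascending+#descending))

lemma3p6 : (n : ℕ) (R : FinGroup n) (Q : Subset n) (sg : IsSubgroup R Q) (ℓ : ℕ) →
           numDoubleCosets R Q ≡ ℓ →
           cardL R Q * cardL R Q * 2 ^ index R Q sg ≤ 2 ^ (n + numInvolutions R + ℓ)
lemma3p6 n R Q sg ℓ refl = begin
  a * a * 2 ^ index R Q sg         ≤⟨ *-monoʳ-≤ (a * a) (^-monoʳ-≤ 2 index≤#ascending+#descending+#doubleCosets) ⟩
  a * a * 2 ^ (s + t + ℓ)          ≡⟨ cong (a * a *_) (2^[x+y+z] s t ℓ) ⟩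
  a * a * (2 ^ s * 2 ^ t * 2 ^ ℓ)  ≡⟨ a*a*[b*c*d]≡a*b*[a*c]*d a (2 ^ s) (2 ^ t) (2 ^ ℓ) ⟩
  a * 2 ^ s * (a * 2 ^ t) * 2 ^ ℓ  ≤⟨ *-monoˡ-≤ (2 ^ ℓ) (*-mono-≤ Ascending.cardL*2^#selected≤2^#lower
                                                                Descending.cardL*2^#selected≤2^#lower) ⟩
  2 ^ u * 2 ^ d * 2 ^ ℓ            ≡⟨ 2^[x+y+z] u d ℓ ⟨
  2 ^ (u + d + ℓ)                  ≤⟨ ^-monoʳ-≤ 2 (+-monoˡ-≤ ℓ #lowerAscending+#lowerDescending≤n+#involutions) ⟩
  2 ^ (n + numInvolutions R + ℓ)   ∎
  where
  open ≤-Reasoning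
  open Cosets R Q sg
  a s t u d : ℕ
  a = cardL R Q
  s = countFin Ascending.selected?
  t = countFin Descending.selected?
  u = countFin Ascending.lower?
  d = countFin Descending.lower?
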